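{- Let $m\ge 3$ and $n\ge 1$ be integers, $C_m$ the cycle on $m$ vertices and $P_n$ the path with $n$ edges (hence $n+1$ vertices). Then the sparing number of the prism $C_m\times P_n$ is $\varphi(C_m\times P_n)=0$ if $m$ is even and $\varphi(C_m\times P_n)=2n+1$ if $m$ is odd.
   Context: All graphs are simple and finite. For finite sets $A,B\subseteq\mathbb{N}_0$, $A+B=\{a+b:a\in A,b\in B\}$. An integer additive set-indexer (IASI) on a graph $G$ is an injective map $f:V(G)\to\mathcal{P}(\mathbb{N}_0)$ (assigning finite nonempty sets) such that the induced map $f^+(uv)=f(u)+f(v)$ on $E(G)$ is also injective. An IASI is weak if $|f^+(uv)|=\max(|f(u)|,|f(v)|)$ for every edge $uv$. An edge $uv$ is mono-indexed if $|f^+(uv)|=1$. The sparing number $\varphi(G)$ is the minimum, over all weak IASIs of $G$, of the number of mono-indexed edges. The cartesian product $G_1\times G_2$ has vertex set $V(G_1)\times V(G_2)$, with $(u_1,u_2)\sim(v_1,v_2)$ iff either $u_1=v_1$ and $u_2v_2\in E(G_2)$, or $u_2=v_2$ and $u_1v_1\in E(G_1)$. In this paper $P_n$ has $n+1$ vertices. -}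

module Defs where

open import Data.Bool using (Bool; true; false; _∧_; _∨_; T)
open import Data.Nat using (ℕ; zero; suc; _+_; _*_; _≤_; _⊔_; _≡ᵇ_; _<ᵇ_)
open import Data.Fin using (Fin; toℕ; remQuot)
open import Data.List using (List; []; map; concatMap; length; filterᵇ; deduplicateᵇ; cartesianProduct; allFin)
open import Data.List.Membership.Propositional using (_∈_)
open import Data.Product using (Σ; _×_; _,_)
open import Data.Sum using (_⊎_)
open import Function.Bundles using (_⇔_)
open import Relation.Binary.PropositionalEquality using (_≡_; _≢_)

-- A finite simple graph on vertex set Fin N, given by a Boolean adjacency relation.
-- (All graphs built below are symmetric and irreflexive by construction.)
record Graph : Set where
  constructor mkGraph
  field
    N   : ℕ
    adj : Fin N → Fin N → Bool
open Graph public

-- Cycle C_m on vertices 0..m-1 (intended for m ≥ 3).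
cycleAdj : (m : ℕ) → Fin m → Fin m → Bool
cycleAdj m i j =
  (suc (toℕ i) ≡ᵇ toℕ j) ∨ (suc (toℕ j) ≡ᵇ toℕ i)
  ∨ ((toℕ i ≡ᵇ 0) ∧ (suc (toℕ j) ≡ᵇ m)) ∨ ((toℕ j ≡ᵇ 0) ∧ (suc (toℕ i) ≡ᵇ m))

Cycle : ℕ → Graph
Cycle m = mkGraph m (cycleAdj m)

-- Path P_n with n edges, i.e. n+1 vertices 0..n (paper's convention).
Path : ℕ → Graph
Path n = mkGraph (suc n) (λ i j → (suc (toℕ i) ≡ᵇ toℕ j) ∨ (suc (toℕ j) ≡ᵇ toℕ i))

_==F_ : {k : ℕ} → Fin k → Fin k → Bool
i ==F j = toℕ i ≡ᵇ toℕ j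

-- Cartesian product G₁ × G₂; vertex set Fin (N₁ * N₂) ≅ Fin N₁ × Fin N₂ via remQuot.
_□_ : Graph → Graph → Graph
G₁ □ G₂ = mkGraph (N G₁ * N G₂) a
  where
  a : Fin (N G₁ * N G₂) → Fin (N G₁ * N G₂) → Bool
  a i j with remQuot {N G₁} (N G₂) i | remQuot {N G₁} (N G₂) j
  ... | (u₁ , u₂) | (v₁ , v₂) =
    ((u₁ ==F v₁) ∧ adj G₂ u₂ v₂) ∨ ((u₂ ==F v₂) ∧ adj G₁ u₁ v₁)

-- Finite sets of naturals represented by lists (the set of their members).
FSet : Set
FSet = List ℕ

_≈_ : FSet → FSet → Set
A ≈ B = ∀ x → (x ∈ A) ⇔ (x ∈ B)

_⊕_ : FSet → FSet → FSet
A ⊕ B = concatMap (λ a → map (a +_) B) A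

card : FSet → ℕ
card A = length (deduplicateᵇ _≡ᵇ_ A)

module _ (G : Graph) where
  private
    V = Fin (N G)
    E : V → V → Set
    E u v = T (adj G u v)

  IsIASI : (V → FSet) → Set
  IsIASI f =
    (∀ v → f v ≢ [])
    × (∀ u v → f u ≈ f v → u ≡ v)
    × (∀ u v u' v' → E u v → E u' v' → (f u ⊕ f v) ≈ (f u' ⊕ f v') →
         (u ≡ u' × v ≡ v') ⊎ (u ≡ v' × v ≡ u'))

  IsWeakIASI : (V → FSet) → Set
  IsWeakIASI f = IsIASI f × (∀ u v → E u v → card (f u ⊕ f v) ≡ card (f u) ⊔ card (f v))

  -- number of mono-indexed edges (each edge {u,v} counted once, via toℕ u < toℕ v)
  monoCount : (V → FSet) → ℕ
  monoCount f = length (filterᵇ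
    (λ p → let u = Data.Product.proj₁ p ; v = Data.Product.proj₂ p in
       (toℕ u <ᵇ toℕ v) ∧ adj G u v ∧ (card (f u ⊕ f v) ≡ᵇ 1))
    (cartesianProduct (allFin (N G)) (allFin (N G))))

  SparingNumberIs : ℕ → Set
  SparingNumberIs k =
    (Σ (V → FSet) λ f → IsWeakIASI f × monoCount f ≡ k)
    × (∀ f → IsWeakIASI f → k ≤ monoCount f)

-- In a weak IASI every edge has an end indexed by a singleton, because |A + B| > max (|A|, |B|)
-- once both sets have two elements; an edge is then mono-indexed exactly when both its ends are
-- singletons.  Conversely, doubling the sets of an independent set I (with powers of two making
-- all sums distinct) gives a weak IASI whose mono-indexed edges are the edges avoiding I.
--
-- For even m the chessboard colouring of C_m × P_n is proper, so a colour class meets every edge.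
-- For odd m every copy of the odd cycle C_m contains an edge between singletons, and in the next
-- copy one end of that edge is again a singleton, which gives a rung between singletons: 2n + 1
-- mono-indexed edges, told apart by the sum of their row indices.  The black cells outside
-- column 0 are independent and miss exactly one edge for each row sum 0, …, 2n.

module Submission where

open import Defs
open import Level using (0ℓ)
open import Data.Bool using (Bool; true; false; T; _∧_; _∨_; if_then_else_)
open import Data.Bool.Properties as Bool using (T?; T-∧; T-∨)
open import Data.Empty using (⊥-elim)
open import Data.Fin using (Fin; toℕ; remQuot; combine)
open import Data.Fin.Properties
  using (toℕ<n; toℕ-injective; toℕ-fromℕ<; remQuot-combine; combine-remQuot; toℕ-combine)
open import Data.List
  using (List; []; _∷_; _++_; length; map; deduplicateᵇ; filterᵇ; cartesianProduct; allFin; upTo)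
open import Data.List.Properties using (length-++; length-map; length-upTo)
import Data.List.Extrema.Nat as Extrema
open import Data.List.Membership.Propositional using (_∈_)
open import Data.List.Membership.Propositional.Properties
import Data.List.Membership.Setoid.Properties as SetoidMembership
open import Data.List.Relation.Binary.Subset.Propositional using (_⊆_)
open import Data.List.Relation.Unary.All as All using (_∷_)
open import Data.List.Relation.Unary.AllPairs using ([]; _∷_)
open import Data.List.Relation.Unary.Any as Any using (here; there)
open import Data.List.Relation.Unary.Unique.Propositional using (Unique)
import Data.List.Relation.Unary.Unique.Propositional.Properties as Unique
open import Data.Nat
open import Data.Nat.DivMod using (_mod_; m<n⇒m%n≡m)
open import Data.Nat.Properties
open import Data.Parity as ℙ using (Parity; 0ℙ; 1ℙ; _⁻¹)
open import Data.Parity.Properties using (suc-homo-⁻¹; ⁻¹-involutive; p≢p⁻¹; p+p≡0ℙ)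
  renaming (_≟_ to _≟ℙ_; +-homo-+ to parity-+)
open import Data.Product using (∃; ∃₂; _×_; _,_; proj₁; proj₂; swap)
open import Data.Sum as Sum using (_⊎_; inj₁; inj₂)
open import Function using (_∘_; _∘₂_)
open import Function.Bundles using (Equivalence)
open import Relation.Binary.Definitions using (tri<; tri≈; tri>)
open import Relation.Binary.PropositionalEquality
open import Relation.Nullary using (¬_; ¬?; Dec; yes; no; does)
open import Relation.Nullary.Decidable using (_×-dec_)
open import Relation.Unary using (Pred; Decidable)

unique-⊆⇒length≤ : ∀ {A : Set} {xs ys : List A} → Unique xs → xs ⊆ ys → length xs ≤ length ys
unique-⊆⇒length≤ {xs = []} _ _ = z≤n
unique-⊆⇒length≤ {xs = x ∷ xs} {ys} (x∉xs ∷ !xs) xs⊆ys with ∈-∃++ (xs⊆ys (here refl))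
... | us , vs , refl = begin
  suc (length xs)          ≤⟨ s≤s (unique-⊆⇒length≤ !xs xs⊆us++vs) ⟩
  suc (length (us ++ vs))  ≡⟨ cong suc (length-++ us) ⟩
  suc (length us + length vs) ≡⟨ +-suc (length us) (length vs) ⟨
  length us + length (x ∷ vs) ≡⟨ length-++ us ⟨
  length (us ++ x ∷ vs)    ∎
  where
  open ≤-Reasoning
  remove : ∀ {w} (us : List _) → w ∈ us ++ x ∷ vs → w ≢ x → w ∈ us ++ vs
  remove []       (here w≡x) w≢x = ⊥-elim (w≢x w≡x)
  remove []       (there w∈) _   = w∈
  remove (_ ∷ us) (here w≡u) _   = here w≡u
  remove (_ ∷ us) (there w∈) w≢x = there (remove us w∈ w≢x)
  xs⊆us++vs : xs ⊆ us ++ vs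
  xs⊆us++vs w∈xs = remove us (xs⊆ys (there w∈xs)) (λ w≡x → All.lookup x∉xs w∈xs (sym w≡x))

dedup : List ℕ → List ℕ
dedup = deduplicateᵇ _≡ᵇ_

dedup-⊆ : ∀ xs → dedup xs ⊆ xs
dedup-⊆ = ∈-deduplicate⁻ (T? ∘₂ _≡ᵇ_)

⊆-dedup : ∀ xs → xs ⊆ dedup xs
⊆-dedup xs = SetoidMembership.∈-deduplicate⁺ (setoid ℕ) (T? ∘₂ _≡ᵇ_)
  (λ {_} {y} {z} z≡ᵇy x≡y → trans x≡y (sym (≡ᵇ⇒≡ z y z≡ᵇy)))

dedup-unique : ∀ xs → Unique (dedup xs)
dedup-unique [] = []
dedup-unique (x ∷ xs) =
  All.tabulate (λ y∈ x≡y → proj₂ (∈-filter⁻ (¬? ∘ T? ∘ (x ≡ᵇ_)) {xs = dedup xs} y∈)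
                                  (≡⇒≡ᵇ x _ x≡y))
  ∷ Unique.filter⁺ (¬? ∘ T? ∘ (x ≡ᵇ_)) (dedup-unique xs)

unique-⊆⇒≤card : ∀ {xs} A → Unique xs → xs ⊆ A → length xs ≤ card A
unique-⊆⇒≤card A !xs xs⊆A = unique-⊆⇒length≤ !xs (⊆-dedup A ∘ xs⊆A)

card-mono : ∀ {A B} → A ⊆ B → card A ≤ card B
card-mono {A} {B} A⊆B = unique-⊆⇒≤card B (dedup-unique A) (A⊆B ∘ dedup-⊆ A)

card-pair : ∀ {x y} → x ≢ y → card (x ∷ y ∷ []) ≡ 2
card-pair {x} {y} x≢y with x ≡ᵇ y in eq
... | true  = ⊥-elim (x≢y (≡ᵇ⇒≡ x y (subst T (sym eq) _)))
... | false = refl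

∈-⊕⁺ : ∀ {a b A B} → a ∈ A → b ∈ B → a + b ∈ A ⊕ B
∈-⊕⁺ {a} {b} {A} {B} a∈A b∈B =
  ∈-concatMap⁺ (λ a → map (a +_) B) (Any.map (λ { refl → ∈-map⁺ (a +_) b∈B }) a∈A)

∈-⊕⁻ : ∀ {x} A B → x ∈ A ⊕ B → ∃₂ λ a b → a ∈ A × b ∈ B × x ≡ a + b
∈-⊕⁻ (a ∷ A) B x∈ with ∈-++⁻ (map (a +_) B) x∈
... | inj₁ x∈a+B with b , b∈B , refl ← ∈-map⁻ (a +_) x∈a+B =
  a , b , here refl , b∈B , refl
... | inj₂ x∈A+B with a′ , b , a′∈A , b∈B , refl ← ∈-⊕⁻ A B x∈A+B =
  a′ , b , there a′∈A , b∈B , refl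

⊕-comm-⊆ : ∀ A B → A ⊕ B ⊆ B ⊕ A
⊕-comm-⊆ A B x∈ with a , b , a∈A , b∈B , refl ← ∈-⊕⁻ A B x∈ =
  subst (_∈ B ⊕ A) (+-comm b a) (∈-⊕⁺ b∈B a∈A)

card-⊕-comm : ∀ A B → card (A ⊕ B) ≡ card (B ⊕ A)
card-⊕-comm A B = ≤-antisym (card-mono (⊕-comm-⊆ A B)) (card-mono (⊕-comm-⊆ B A))

card-nonempty : ∀ {A} → A ≢ [] → 1 ≤ card A
card-nonempty {[]}    A≢[] = ⊥-elim (A≢[] refl)
card-nonempty {_ ∷ _} _    = s≤s z≤n

two-distinct : ∀ B → 2 ≤ card B → ∃₂ λ b₁ b₂ → b₁ ∈ B × b₂ ∈ B × b₁ < b₂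
two-distinct B 2≤|B| = pick (dedup B) (dedup-unique B) (dedup-⊆ B) 2≤|B|
  where
  pick : ∀ xs → Unique xs → xs ⊆ B → 2 ≤ length xs →
         ∃₂ λ b₁ b₂ → b₁ ∈ B × b₂ ∈ B × b₁ < b₂
  pick (x ∷ y ∷ _) ((x≢y ∷ _) ∷ _) xs⊆B _ with <-cmp x y
  ... | tri< x<y _ _ = x , y , xs⊆B (here refl) , xs⊆B (there (here refl)) , x<y
  ... | tri≈ _ x≡y _ = ⊥-elim (x≢y x≡y)
  ... | tri> _ _ y<x = y , x , xs⊆B (there (here refl)) , xs⊆B (here refl) , y<x
  pick (_ ∷ []) _ _ (s≤s ())

-- With a the largest element of A and b₁ < b₂ in B, the sums a′ + b₁ (a′ ∈ A) are
-- card A distinct elements of A ⊕ B, all smaller than a + b₂.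
card-⊕-growsˡ : ∀ A B → A ≢ [] → 2 ≤ card B → suc (card A) ≤ card (A ⊕ B)
card-⊕-growsˡ [] B A≢[] _ = ⊥-elim (A≢[] refl)
card-⊕-growsˡ A@(a₀ ∷ A′) B _ 2≤|B|
  with b₁ , b₂ , b₁∈B , b₂∈B , b₁<b₂ ← two-distinct B 2≤|B| =
  subst (_≤ card (A ⊕ B)) (cong suc (length-map (_+ b₁) (dedup A)))
    (unique-⊆⇒≤card (A ⊕ B) sums-unique sums-⊆)
  where
  a = Extrema.max a₀ A′
  a-max : ∀ {x} → x ∈ A → x ≤ a
  a-max (here refl) = Extrema.⊥≤max a₀ A′
  a-max (there x∈)  = All.lookup (Extrema.xs≤max a₀ A′) x∈
  a∈A : a ∈ A
  a∈A with Extrema.argmax-sel (λ x → x) a₀ A′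
  ... | inj₁ a≡a₀ = here a≡a₀
  ... | inj₂ a∈A′ = there a∈A′
  sums = (a + b₂) ∷ map (_+ b₁) (dedup A)
  sums-unique : Unique sums
  sums-unique =
    All.tabulate (λ y∈ a+b₂≡y → let (x , x∈ , y≡x+b₁) = ∈-map⁻ (_+ b₁) y∈ in
      <⇒≢ (+-mono-≤-< (a-max (dedup-⊆ A x∈)) b₁<b₂) (sym (trans a+b₂≡y y≡x+b₁)))
    ∷ Unique.map⁺ (+-cancelʳ-≡ b₁ _ _) (dedup-unique A)
  sums-⊆ : sums ⊆ A ⊕ B
  sums-⊆ (here refl) = ∈-⊕⁺ a∈A b₂∈B
  sums-⊆ (there y∈) with x , x∈ , refl ← ∈-map⁻ (_+ b₁) y∈ = ∈-⊕⁺ (dedup-⊆ A x∈) b₁∈B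

card-⊕-growsʳ : ∀ A B → 2 ≤ card A → B ≢ [] → suc (card B) ≤ card (A ⊕ B)
card-⊕-growsʳ A B 2≤|A| B≢[] =
  subst (suc (card B) ≤_) (card-⊕-comm B A) (card-⊕-growsˡ B A B≢[] 2≤|A|)

weak-sum⇒singleton : ∀ A B → A ≢ [] → B ≢ [] → card (A ⊕ B) ≡ card A ⊔ card B →
                     card A ≡ 1 ⊎ card B ≡ 1
weak-sum⇒singleton A B A≢[] B≢[] weak
  with m≤n⇒m<n∨m≡n (card-nonempty A≢[]) | m≤n⇒m<n∨m≡n (card-nonempty B≢[])
... | inj₂ 1≡|A| | _          = inj₁ (sym 1≡|A|)
... | _          | inj₂ 1≡|B| = inj₂ (sym 1≡|B|)
... | inj₁ 2≤|A| | inj₁ 2≤|B| with ⊔-sel (card A) (card B)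
...   | inj₁ ⊔≡|A| = ⊥-elim (<-irrefl (sym (trans weak ⊔≡|A|)) (card-⊕-growsˡ A B A≢[] 2≤|B|))
...   | inj₂ ⊔≡|B| = ⊥-elim (<-irrefl (sym (trans weak ⊔≡|B|)) (card-⊕-growsʳ A B 2≤|A| B≢[]))

2^-mono-< : ∀ {a b} → a < b → 2 ^ a < 2 ^ b
2^-mono-< = ^-monoʳ-< 2 (s≤s (s≤s z≤n))

2^-injective : ∀ {a b} → 2 ^ a ≡ 2 ^ b → a ≡ b
2^-injective {a} {b} eq with <-cmp a b
... | tri< a<b _ _ = ⊥-elim (<-irrefl eq (2^-mono-< a<b))
... | tri≈ _ a≡b _ = a≡b
... | tri> _ _ b<a = ⊥-elim (<-irrefl (sym eq) (2^-mono-< b<a))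

2^+2^-bounds : ∀ {a b} → a < b → 2 ^ b ≤ 2 ^ a + 2 ^ b × 2 ^ a + 2 ^ b < 2 ^ suc b
2^+2^-bounds {a} {b} a<b =
  m≤n+m (2 ^ b) (2 ^ a) ,
  subst (2 ^ a + 2 ^ b <_) (cong (2 ^ b +_) (sym (+-identityʳ (2 ^ b)))) (+-monoˡ-< (2 ^ b) (2^-mono-< a<b))

2^+2^-injective : ∀ {a b c d} → a < b → c < d → 2 ^ a + 2 ^ b ≡ 2 ^ c + 2 ^ d → a ≡ c × b ≡ d
2^+2^-injective {a} {b} {c} {d} a<b c<d eq = a≡c , b≡d
  where
  smaller-top : ∀ {x y z w} → x < y → z < w → y < w → 2 ^ x + 2 ^ y < 2 ^ z + 2 ^ w
  smaller-top x<y z<w y<w = <-≤-trans (proj₂ (2^+2^-bounds x<y))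
    (≤-trans (^-monoʳ-≤ 2 y<w) (proj₁ (2^+2^-bounds z<w)))
  b≡d : b ≡ d
  b≡d with <-cmp b d
  ... | tri< b<d _ _ = ⊥-elim (<-irrefl eq (smaller-top a<b c<d b<d))
  ... | tri≈ _ b≡d _ = b≡d
  ... | tri> _ _ d<b = ⊥-elim (<-irrefl (sym eq) (smaller-top c<d a<b d<b))
  a≡c : a ≡ c
  a≡c = 2^-injective (+-cancelʳ-≡ (2 ^ b) (2 ^ a) (2 ^ c) (trans eq (cong (λ x → 2 ^ c + 2 ^ x) (sym b≡d))))

2^+2^-injective-unordered : ∀ {a b c d} → a ≢ b → c ≢ d → 2 ^ a + 2 ^ b ≡ 2 ^ c + 2 ^ d →
                            (a ≡ c × b ≡ d) ⊎ (a ≡ d × b ≡ c)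
2^+2^-injective-unordered {a} {b} {c} {d} a≢b c≢d eq with <-cmp a b | <-cmp c d
... | tri≈ _ a≡b _ | _ = ⊥-elim (a≢b a≡b)
... | _ | tri≈ _ c≡d _ = ⊥-elim (c≢d c≡d)
... | tri< a<b _ _ | tri< c<d _ _ = inj₁ (2^+2^-injective a<b c<d eq)
... | tri< a<b _ _ | tri> _ _ d<c =
  inj₂ (2^+2^-injective a<b d<c (trans eq (+-comm (2 ^ c) (2 ^ d))))
... | tri> _ _ b<a | tri< c<d _ _ =
  inj₂ (swap (2^+2^-injective b<a c<d (trans (+-comm (2 ^ b) (2 ^ a)) eq)))
... | tri> _ _ b<a | tri> _ _ d<c =
  inj₁ (swap (2^+2^-injective b<a d<c (trans (+-comm (2 ^ b) (2 ^ a)) (trans eq (+-comm (2 ^ c) (2 ^ d))))))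

Loopless : Graph → Set
Loopless G = ∀ u → ¬ T (adj G u u)

module _ {G : Graph} {f : Fin (N G) → FSet} (weak : IsWeakIASI G f) where

  weak⇒singleton-endpoint : ∀ {u v} → T (adj G u v) → card (f u) ≡ 1 ⊎ card (f v) ≡ 1
  weak⇒singleton-endpoint {u} {v} uv =
    weak-sum⇒singleton (f u) (f v) (proj₁ (proj₁ weak) u) (proj₁ (proj₁ weak) v) (proj₂ weak u v uv)

  weak⇒singletons-mono : ∀ {u v} → T (adj G u v) → card (f u) ≡ 1 → card (f v) ≡ 1 →
                         card (f u ⊕ f v) ≡ 1
  weak⇒singletons-mono {u} {v} uv |fu|≡1 |fv|≡1 = trans (proj₂ weak u v uv) (cong₂ _⊔_ |fu|≡1 |fv|≡1)

module MonoEdges (G : Graph) (f : Fin (N G) → FSet) where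

  private
    V = Fin (N G)

  -- Ordering the endpoints by index counts each mono-indexed edge once, as monoCount does.
  IsMonoEdge : V → V → Set
  IsMonoEdge u v = toℕ u < toℕ v × T (adj G u v) × card (f u ⊕ f v) ≡ 1

  private
    isMonoEdge : V × V → Bool
    isMonoEdge (u , v) = (toℕ u <ᵇ toℕ v) ∧ adj G u v ∧ (card (f u ⊕ f v) ≡ᵇ 1)

    monoEdges : List (V × V)
    monoEdges = filterᵇ isMonoEdge (cartesianProduct (allFin (N G)) (allFin (N G)))

    monoEdges-unique : Unique monoEdges
    monoEdges-unique = Unique.filter⁺ (T? ∘ isMonoEdge)
      (Unique.cartesianProduct⁺ (Unique.allFin⁺ (N G)) (Unique.allFin⁺ (N G)))

    ∈-monoEdges⁺ : ∀ {u v} → IsMonoEdge u v → (u , v) ∈ monoEdges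
    ∈-monoEdges⁺ {u} {v} (u<v , uv , mono) =
      ∈-filter⁺ (T? ∘ isMonoEdge) (∈-cartesianProduct⁺ (∈-allFin u) (∈-allFin v))
        (Equivalence.from T-∧ (<⇒<ᵇ u<v , Equivalence.from T-∧ (uv , ≡⇒≡ᵇ _ 1 mono)))

    ∈-monoEdges⁻ : ∀ {u v} → (u , v) ∈ monoEdges → IsMonoEdge u v
    ∈-monoEdges⁻ {u} {v} uv∈
      with _ , tests ← ∈-filter⁻ (T? ∘ isMonoEdge) {xs = cartesianProduct (allFin (N G)) (allFin (N G))} uv∈
      with u<ᵇv , rest ← Equivalence.to T-∧ tests
      with uv , mono ← Equivalence.to T-∧ rest = <ᵇ⇒< _ _ u<ᵇv , uv , ≡ᵇ⇒≡ _ 1 mono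

  monoCount-≤ : (es : List (V × V)) → (∀ {u v} → IsMonoEdge u v → (u , v) ∈ es) →
                monoCount G f ≤ length es
  monoCount-≤ es mono⇒∈ = unique-⊆⇒length≤ monoEdges-unique (mono⇒∈ ∘ ∈-monoEdges⁻)

  ≤-monoCount : ∀ (key : V → V → ℕ) K → (∀ j → j < K → ∃₂ λ u v → IsMonoEdge u v × key u v ≡ j) →
                K ≤ monoCount G f
  ≤-monoCount key K hit = subst₂ _≤_ (length-upTo K) (length-map (λ (u , v) → key u v) monoEdges)
    (unique-⊆⇒length≤ (Unique.upTo⁺ K) upTo⊆keys)
    where
    upTo⊆keys : upTo K ⊆ map (λ (u , v) → key u v) monoEdges
    upTo⊆keys j∈ with u , v , mono , refl ← hit _ (∈-upTo⁻ j∈) =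
      ∈-map⁺ (λ (u , v) → key u v) (∈-monoEdges⁺ mono)

-- The shift D = 2^(N+1) exceeds every sum 2^u + 2^v, so such sums are told apart by their binary
-- expansions and the shift is visible in every sum it enters.
module IndependentSetIndexer (G : Graph) (loopless : Loopless G) {I : Pred (Fin (N G)) 0ℓ} (I? : Decidable I)
       (independent : ∀ {u v} → T (adj G u v) → I u → ¬ I v) where

  private
    V = Fin (N G)

    code : V → ℕ
    code u = 2 ^ toℕ u

    shift : ℕ
    shift = 2 ^ suc (N G)

    code+code<shift : ∀ u v → code u + code v < shift
    code+code<shift u v = subst (code u + code v <_) (cong (2 ^ N G +_) (sym (+-identityʳ (2 ^ N G))))
      (+-mono-< (2^-mono-< (toℕ<n u)) (2^-mono-< (toℕ<n v)))

    x≢x+shift : ∀ x → x ≢ x + shift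
    x≢x+shift x = <⇒≢ (m<m+n x (m^n>0 2 (suc (N G))))

    pair-card : ∀ x → card (x ∷ x + shift ∷ []) ≡ 2
    pair-card x = card-pair (x≢x+shift x)

    1≢2 : 1 ≢ 2
    1≢2 ()

  indexer : V → FSet
  indexer u = code u ∷ (if does (I? u) then code u + shift ∷ [] else [])

  private
    ∈-indexer⁻ : ∀ {x} u → x ∈ indexer u → x ≡ code u ⊎ x ≡ code u + shift
    ∈-indexer⁻ u (here x≡) = inj₁ x≡
    ∈-indexer⁻ u (there x∈) with I? u | x∈
    ... | yes _ | here x≡ = inj₂ x≡

    indexer-injective : ∀ u v → indexer u ≈ indexer v → u ≡ v
    indexer-injective u v same with ∈-indexer⁻ v (Equivalence.to (same (code u)) (here refl))
    ... | inj₁ cu≡cv = toℕ-injective (2^-injective cu≡cv)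
    ... | inj₂ cu≡cv+D = ⊥-elim (<-irrefl cu≡cv+D
      (<-≤-trans (≤-<-trans (m≤m+n (code u) (code u)) (code+code<shift u u)) (m≤n+m shift (code v))))

    code+code≢shifted : ∀ u v {x} → shift ≤ x → code u + code v ≢ x
    code+code≢shifted u v shift≤x eq = <-irrefl eq (<-≤-trans (code+code<shift u v) shift≤x)

    unshifted-sum : ∀ u v u′ v′ {x} → x ∈ indexer u′ ⊕ indexer v′ → code u + code v ≡ x →
                    code u + code v ≡ code u′ + code v′
    unshifted-sum u v u′ v′ x∈ eq with a , b , a∈ , b∈ , refl ← ∈-⊕⁻ (indexer u′) (indexer v′) x∈
      with ∈-indexer⁻ u′ a∈ | ∈-indexer⁻ v′ b∈
    ... | inj₁ refl | inj₁ refl = eq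
    ... | inj₂ refl | _         =
      ⊥-elim (code+code≢shifted u v (≤-trans (m≤n+m shift (code u′)) (m≤m+n _ b)) eq)
    ... | inj₁ refl | inj₂ refl =
      ⊥-elim (code+code≢shifted u v (≤-trans (m≤n+m shift (code v′)) (m≤n+m _ (code u′))) eq)

    edge-ends-distinct : ∀ {u v} → T (adj G u v) → toℕ u ≢ toℕ v
    edge-ends-distinct {u} uv u≡v = loopless u (subst (T ∘ adj G u) (sym (toℕ-injective u≡v)) uv)

    indexer-edge-injective : ∀ u v u′ v′ → T (adj G u v) → T (adj G u′ v′) →
                             (indexer u ⊕ indexer v) ≈ (indexer u′ ⊕ indexer v′) →
                             (u ≡ u′ × v ≡ v′) ⊎ (u ≡ v′ × v ≡ u′)
    indexer-edge-injective u v u′ v′ uv u′v′ same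
      with 2^+2^-injective-unordered (edge-ends-distinct uv) (edge-ends-distinct u′v′)
             (unshifted-sum u v u′ v′ (Equivalence.to (same _) (∈-⊕⁺ {A = indexer u} {B = indexer v} (here refl) (here refl)))
                            refl)
    ... | inj₁ (u≡u′ , v≡v′) = inj₁ (toℕ-injective u≡u′ , toℕ-injective v≡v′)
    ... | inj₂ (u≡v′ , v≡u′) = inj₂ (toℕ-injective u≡v′ , toℕ-injective v≡u′)

  indexer-weak : ∀ u v → T (adj G u v) → card (indexer u ⊕ indexer v) ≡ card (indexer u) ⊔ card (indexer v)
  indexer-weak u v uv with I? u | I? v
  ... | yes Iu | yes Iv = ⊥-elim (independent uv Iu Iv)
  ... | yes _  | no _   = trans (card-pair sums-differ) (cong (_⊔ 1) (sym (pair-card (code u))))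
    where
    sums-differ : code u + code v ≢ code u + shift + code v
    sums-differ eq = x≢x+shift (code u + code v) (begin
      code u + code v          ≡⟨ eq ⟩
      code u + shift + code v  ≡⟨ +-assoc (code u) shift (code v) ⟩
      code u + (shift + code v) ≡⟨ cong (code u +_) (+-comm shift (code v)) ⟩
      code u + (code v + shift) ≡⟨ +-assoc (code u) (code v) shift ⟨
      code u + code v + shift  ∎)
      where open ≡-Reasoning
  ... | no _   | yes _  = trans (card-pair sums-differ) (cong (1 ⊔_) (sym (pair-card (code v))))
    where
    sums-differ : code u + code v ≢ code u + (code v + shift)
    sums-differ eq = x≢x+shift (code u + code v) (trans eq (sym (+-assoc (code u) (code v) shift)))
  ... | no _   | no _   = refl

  indexer-isWeakIASI : IsWeakIASI G indexer
  indexer-isWeakIASI = ((λ _ ()) , indexer-injective , indexer-edge-injective) , indexer-weak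

  mono⇒outside : ∀ {u v} → T (adj G u v) → card (indexer u ⊕ indexer v) ≡ 1 → ¬ I u × ¬ I v
  mono⇒outside {u} {v} uv mono with I? u | I? v | indexer-weak u v uv
  ... | yes Iu | yes Iv | _    = ⊥-elim (independent uv Iu Iv)
  ... | yes _  | no _   | weak = ⊥-elim (1≢2 (trans (sym mono) (trans weak (cong (_⊔ 1) (pair-card (code u))))))
  ... | no _   | yes _  | weak = ⊥-elim (1≢2 (trans (sym mono) (trans weak (cong (1 ⊔_) (pair-card (code v))))))
  ... | no ¬Iu | no ¬Iv | _    = ¬Iu , ¬Iv

data CycleEdge (m : ℕ) : ℕ → ℕ → Set where
  step  : ∀ {i} → suc i < m → CycleEdge m i (suc i)
  close : CycleEdge m 0 (pred m)

private
  two-flips : ∀ (a b c : Bool) → a ≢ b → b ≢ c → a ≡ c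
  two-flips false false _     a≢b _   = ⊥-elim (a≢b refl)
  two-flips true  true  _     a≢b _   = ⊥-elim (a≢b refl)
  two-flips _     false false _   b≢c = ⊥-elim (b≢c refl)
  two-flips _     true  true  _   b≢c = ⊥-elim (b≢c refl)
  two-flips false true  false _   _   = refl
  two-flips true  false true  _   _   = refl

even-path-monochromatic-or-ends-agree : (g : ℕ → Bool) → ∀ j → parity j ≡ 0ℙ →
  (∃ λ i → suc i ≤ j × g i ≡ g (suc i)) ⊎ g j ≡ g 0
even-path-monochromatic-or-ends-agree g zero          _    = inj₂ refl
even-path-monochromatic-or-ends-agree g (suc (suc j)) even
  with even-path-monochromatic-or-ends-agree g j even
... | inj₁ (i , i<j , same) = inj₁ (i , m≤n⇒m≤1+n (m≤n⇒m≤1+n i<j) , same)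
... | inj₂ ends with g j Bool.≟ g (suc j) | g (suc j) Bool.≟ g (suc (suc j))
...   | yes same | _        = inj₁ (j , m≤n⇒m≤1+n ≤-refl , same)
...   | no _     | yes same = inj₁ (suc j , ≤-refl , same)
...   | no flip₁ | no flip₂ = inj₂ (trans (sym (two-flips _ _ _ flip₁ flip₂)) ends)

odd-cycle-monochromatic-edge : ∀ m → parity m ≡ 1ℙ → (g : ℕ → Bool) →
  ∃₂ λ p q → CycleEdge m p q × g p ≡ g q
odd-cycle-monochromatic-edge (suc j) odd g
  with even-path-monochromatic-or-ends-agree g j (trans (sym (suc-homo-⁻¹ j)) (cong _⁻¹ odd))
... | inj₁ (i , i<j , same) = i , suc i , step (s≤s i<j) , same
... | inj₂ ends = 0 , j , close , sym ends

%2≡0⇒parity≡0ℙ : ∀ m → m % 2 ≡ 0 → parity m ≡ 0ℙ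
%2≡0⇒parity≡0ℙ zero          _ = refl
%2≡0⇒parity≡0ℙ (suc (suc m)) e = %2≡0⇒parity≡0ℙ m e

%2≡1⇒parity≡1ℙ : ∀ m → m % 2 ≡ 1 → parity m ≡ 1ℙ
%2≡1⇒parity≡1ℙ (suc zero)    _ = refl
%2≡1⇒parity≡1ℙ (suc (suc m)) e = %2≡1⇒parity≡1ℙ m e

halve : ∀ j → ∃ λ h → j ≡ h + h ⊎ j ≡ suc (h + h)
halve zero = 0 , inj₁ refl
halve (suc zero) = 0 , inj₂ refl
halve (suc (suc j)) with halve j
... | h , inj₁ refl = suc h , inj₁ (cong suc (sym (+-suc h h)))
... | h , inj₂ refl = suc h , inj₂ (cong (suc ∘ suc) (sym (+-suc h h)))

double-cancel-≤ : ∀ {h n} → h + h ≤ n + n → h ≤ n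
double-cancel-≤ {h} {n} h+h≤n+n with h ≤? n
... | yes h≤n = h≤n
... | no h≰n  = ⊥-elim (<⇒≱ (+-mono-< (≰⇒> h≰n) (≰⇒> h≰n)) h+h≤n+n)

double-cancel-< : ∀ {h n} → h + h < n + n → h < n
double-cancel-< {h} {n} h+h<n+n with h <? n
... | yes h<n = h<n
... | no h≮n  = ⊥-elim (<⇒≱ h+h<n+n (+-mono-≤ (≮⇒≥ h≮n) (≮⇒≥ h≮n)))

2*n+1≡1+n+n : ∀ n → 2 * n + 1 ≡ suc (n + n)
2*n+1≡1+n+n n = trans (+-comm (2 * n) 1) (cong (λ x → suc (n + x)) (+-identityʳ n))

parity-suc : ∀ x → parity (suc x) ≡ parity x ⁻¹
parity-suc x = trans (sym (⁻¹-involutive (parity (suc x)))) (cong _⁻¹ (suc-homo-⁻¹ x))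

parity≢parity-suc : ∀ x → parity x ≢ parity (suc x)
parity≢parity-suc x eq = p≢p⁻¹ (parity x) (trans eq (parity-suc x))

parity-double : ∀ r → parity (r + r) ≡ 0ℙ
parity-double r = trans (parity-+ r r) (p+p≡0ℙ (parity r))

⌊1+n+n/2⌋≡n : ∀ r → ⌊ suc (r + r) /2⌋ ≡ r
⌊1+n+n/2⌋≡n zero    = refl
⌊1+n+n/2⌋≡n (suc r) = cong suc (trans (cong ⌊_/2⌋ (+-suc r r)) (⌊1+n+n/2⌋≡n r))

≢1ℙ⇒≡0ℙ : ∀ {p} → p ≢ 1ℙ → p ≡ 0ℙ
≢1ℙ⇒≡0ℙ {0ℙ} _    = refl
≢1ℙ⇒≡0ℙ {1ℙ} p≢1ℙ = ⊥-elim (p≢1ℙ refl)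

⁻¹≡0ℙ⇒≡1ℙ : ∀ {p} → p ⁻¹ ≡ 0ℙ → p ≡ 1ℙ
⁻¹≡0ℙ⇒≡1ℙ {1ℙ} _ = refl

module Prism (k n : ℕ) where

  m K : ℕ
  m = suc (suc (suc k))
  K = suc n

  G : Graph
  G = Cycle m □ Path n

  V : Set
  V = Fin (m * K)

  col row : V → ℕ
  col u = toℕ (proj₁ (remQuot {m} K u))
  row u = toℕ (proj₂ (remQuot {m} K u))

  row<K : ∀ u → row u < K
  row<K u = toℕ<n (proj₂ (remQuot {m} K u))

  cell : ℕ → ℕ → V
  cell i r = combine (i mod m) (r mod K)

  col-cell : ∀ {i} r → i < m → col (cell i r) ≡ i
  col-cell {i} r i<m = trans (cong (toℕ ∘ proj₁) (remQuot-combine {m} {K} (i mod m) (r mod K)))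
                                (trans (toℕ-fromℕ< _) (m<n⇒m%n≡m i<m))

  row-cell : ∀ i {r} → r < K → row (cell i r) ≡ r
  row-cell i {r} r<K = trans (cong (toℕ ∘ proj₂) (remQuot-combine {m} {K} (i mod m) (r mod K)))
                                (trans (toℕ-fromℕ< _) (m<n⇒m%n≡m r<K))

  toℕ≡K*col+row : ∀ u → toℕ u ≡ K * col u + row u
  toℕ≡K*col+row u = trans (cong toℕ (sym (combine-remQuot {m} K u)))
                          (toℕ-combine (proj₁ (remQuot {m} K u)) (proj₂ (remQuot {m} K u)))

  toℕ-cell : ∀ {i r} → i < m → r < K → toℕ (cell i r) ≡ K * i + r
  toℕ-cell {i} {r} i<m r<K =
    trans (toℕ≡K*col+row _) (cong₂ (λ i r → K * i + r) (col-cell r i<m) (row-cell i r<K))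

  cell-col-row : ∀ u → cell (col u) (row u) ≡ u
  cell-col-row u =
    toℕ-injective (trans (toℕ-cell (toℕ<n (proj₁ (remQuot {m} K u))) (row<K u)) (sym (toℕ≡K*col+row u)))

  data Edge : ℕ → ℕ → ℕ → ℕ → Set where
    up     : ∀ {i r} → Edge i r i (suc r)
    down   : ∀ {i r} → Edge i (suc r) i r
    right  : ∀ {i r} → Edge i r (suc i) r
    left   : ∀ {i r} → Edge (suc i) r i r
    wrap   : ∀ {r} → Edge 0 r (pred m) r
    unwrap : ∀ {r} → Edge (pred m) r 0 r

  private
    cycleAdjℕ : ℕ → ℕ → Bool
    cycleAdjℕ i j = (suc i ≡ᵇ j) ∨ (suc j ≡ᵇ i) ∨ ((i ≡ᵇ 0) ∧ (suc j ≡ᵇ m)) ∨ ((j ≡ᵇ 0) ∧ (suc i ≡ᵇ m))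

    adjℕ : ℕ → ℕ → ℕ → ℕ → Bool
    adjℕ i r j s = ((i ≡ᵇ j) ∧ ((suc r ≡ᵇ s) ∨ (suc s ≡ᵇ r))) ∨ ((r ≡ᵇ s) ∧ cycleAdjℕ i j)

    adj-cells : ∀ {i r j s} → i < m → r < K → j < m → s < K →
                T (adjℕ i r j s) → T (adj G (cell i r) (cell j s))
    adj-cells {i} {r} {j} {s} i<m r<K j<m s<K = subst T (sym (cong₂ (λ (i , r) (j , s) → adjℕ i r j s)
      (cong₂ _,_ (col-cell r i<m) (row-cell i r<K)) (cong₂ _,_ (col-cell s j<m) (row-cell j s<K))))

    ≡ᵇ-refl : ∀ a → T (a ≡ᵇ a)
    ≡ᵇ-refl a = ≡⇒≡ᵇ a a refl

    ∨ˡ : ∀ {x y} → T x → T (x ∨ y)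
    ∨ˡ = Equivalence.from T-∨ ∘ inj₁

    ∨ʳ : ∀ {x y} → T y → T (x ∨ y)
    ∨ʳ = Equivalence.from T-∨ ∘ inj₂

    ∧-intro : ∀ {x y} → T x → T y → T (x ∧ y)
    ∧-intro tx ty = Equivalence.from T-∧ (tx , ty)

    ≡ᵇ-pair : ∀ a b c d → T ((a ≡ᵇ b) ∧ (c ≡ᵇ d)) → a ≡ b × c ≡ d
    ≡ᵇ-pair a b c d t with ab , cd ← Equivalence.to T-∧ t = ≡ᵇ⇒≡ a b ab , ≡ᵇ⇒≡ c d cd

    vertical : ∀ i r j s → i ≡ j → suc r ≡ s ⊎ suc s ≡ r → Edge i r j s
    vertical i r .i .(suc r) refl (inj₁ refl) = up
    vertical i .(suc s) .i s refl (inj₂ refl) = down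

    horizontal : ∀ i r j s → r ≡ s → suc i ≡ j ⊎ suc j ≡ i ⊎ (i ≡ 0 × suc j ≡ m) ⊎ (j ≡ 0 × suc i ≡ m) →
                 Edge i r j s
    horizontal i r .(suc i) .r refl (inj₁ refl)                      = right
    horizontal .(suc j) r j .r refl (inj₂ (inj₁ refl))               = left
    horizontal .0 r .(suc (suc k)) .r refl (inj₂ (inj₂ (inj₁ (refl , refl)))) = wrap
    horizontal .(suc (suc k)) r .0 .r refl (inj₂ (inj₂ (inj₂ (refl , refl)))) = unwrap

    decode : ∀ i r j s → T (adjℕ i r j s) → Edge i r j s
    decode i r j s t with Equivalence.to T-∨ t
    ... | inj₁ t′ with i≡j , rows ← Equivalence.to T-∧ t′ =
      vertical i r j s (≡ᵇ⇒≡ i j i≡j) (Sum.map (≡ᵇ⇒≡ _ _) (≡ᵇ⇒≡ _ _) (Equivalence.to T-∨ rows))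
    ... | inj₂ t′ with r≡s , cols ← Equivalence.to T-∧ t′ =
      horizontal i r j s (≡ᵇ⇒≡ r s r≡s)
        (Sum.map (≡ᵇ⇒≡ _ _) (Sum.map (≡ᵇ⇒≡ _ _) (Sum.map (≡ᵇ-pair _ _ _ _) (≡ᵇ-pair _ _ _ _)))
          (Sum.map₂ (Sum.map₂ (Equivalence.to T-∨) ∘ Equivalence.to T-∨) (Equivalence.to T-∨ cols)))

  edge : ∀ {u v} → T (adj G u v) → Edge (col u) (row u) (col v) (row v)
  edge {u} {v} = decode (col u) (row u) (col v) (row v)

  Edge-irreflexive : ∀ {i r} → ¬ Edge i r i r
  Edge-irreflexive ()

  loopless : Loopless G
  loopless u = Edge-irreflexive ∘ edge {u} {u}

  cycle-adj : ∀ {p q r} → CycleEdge m p q → r < K → T (adj G (cell p r) (cell q r))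
  cycle-adj {r = r} (step {i} i+1<m) r<K =
    adj-cells (<-trans (n<1+n i) i+1<m) r<K i+1<m r<K (∨ʳ (∧-intro (≡ᵇ-refl r) (∨ˡ (≡ᵇ-refl i))))
  cycle-adj {r = r} close r<K =
    adj-cells (s≤s z≤n) r<K ≤-refl r<K (∨ʳ (∧-intro (≡ᵇ-refl r) (∨ˡ (≡ᵇ-refl m))))

  rung-adj : ∀ {i r} → i < m → suc r < K → T (adj G (cell i r) (cell i (suc r)))
  rung-adj {i} {r} i<m r+1<K =
    adj-cells i<m (<-trans (n<1+n r) r+1<K) i<m r+1<K (∨ˡ (∧-intro (≡ᵇ-refl i) (∨ˡ (≡ᵇ-refl r))))

  CycleEdge-bounds : ∀ {p q} → CycleEdge m p q → p < q × q < m
  CycleEdge-bounds (step i+1<m) = n<1+n _ , i+1<m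
  CycleEdge-bounds close        = s≤s z≤n , ≤-refl

  module LowerBound (odd : parity m ≡ 1ℙ) {f : V → FSet} (weak : IsWeakIASI G f) where

    open MonoEdges G f

    Singleton : V → Set
    Singleton u = card (f u) ≡ 1

    key : V → V → ℕ
    key u v = row u + row v

    private
      mono-cells : ∀ {i r j s} → i < m → r < K → j < m → s < K → K * i + r < K * j + s →
                   T (adj G (cell i r) (cell j s)) → Singleton (cell i r) → Singleton (cell j s) →
                   ∃₂ λ u v → IsMonoEdge u v × key u v ≡ r + s
      mono-cells {i} {r} {j} {s} i<m r<K j<m s<K lt adj sᵤ sᵥ =
        cell i r , cell j s ,
        (subst₂ _<_ (sym (toℕ-cell i<m r<K)) (sym (toℕ-cell j<m s<K)) lt , adj ,
         weak⇒singletons-mono weak adj sᵤ sᵥ) ,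
        cong₂ _+_ (row-cell i r<K) (row-cell j s<K)

      both-if-same : ∀ {A B : Set} (a? : Dec A) (b? : Dec B) → does a? ≡ does b? → A ⊎ B → A × B
      both-if-same (yes a) (yes b) _  _        = a , b
      both-if-same (no ¬a) (no ¬b) _  (inj₁ a) = ⊥-elim (¬a a)
      both-if-same (no ¬a) (no ¬b) _  (inj₂ b) = ⊥-elim (¬b b)
      both-if-same (yes _) (no _)  ()
      both-if-same (no _)  (yes _) ()

    -- Every edge has a singleton end, so colouring row r by "is a singleton" and taking a
    -- monochromatic edge of the odd cycle yields an edge with two singleton ends.
    row-singleton-edge : ∀ {r} → r < K →
                         ∃₂ λ p q → CycleEdge m p q × Singleton (cell p r) × Singleton (cell q r)
    row-singleton-edge {r} r<K
      with p , q , pq , same ← odd-cycle-monochromatic-edge m odd (λ i → does (card (f (cell i r)) ≟ 1)) =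
      p , q , pq , both-if-same (card (f (cell p r)) ≟ 1) (card (f (cell q r)) ≟ 1) same
                     (weak⇒singleton-endpoint weak (cycle-adj pq r<K))

    row-mono-edge : ∀ {r} → r < K → ∃₂ λ u v → IsMonoEdge u v × key u v ≡ r + r
    row-mono-edge {r} r<K with p , q , pq , sp , sq ← row-singleton-edge r<K =
      let p<q , q<m = CycleEdge-bounds pq in
      mono-cells (<-trans p<q q<m) r<K q<m r<K (+-monoˡ-< r (*-monoʳ-< K p<q)) (cycle-adj pq r<K) sp sq

    private
      singleton-rung : ∀ {i r} → i < m → suc r < K → Singleton (cell i r) → Singleton (cell i (suc r)) →
                       ∃₂ λ u v → IsMonoEdge u v × key u v ≡ suc (r + r)
      singleton-rung {i} {r} i<m r+1<K sᵣ sᵣ₊₁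
        with u , v , mono , key≡ ← mono-cells i<m (<-trans (n<1+n r) r+1<K) i<m r+1<K (+-monoʳ-< (K * i) (n<1+n r))
                                              (rung-adj i<m r+1<K) sᵣ sᵣ₊₁ =
        u , v , mono , trans key≡ (+-suc r r)

    -- In the next row one end of that edge is again a singleton, giving a rung between singletons.
    rung-mono-edge : ∀ {r} → suc r < K → ∃₂ λ u v → IsMonoEdge u v × key u v ≡ suc (r + r)
    rung-mono-edge {r} r+1<K
      with p , q , pq , sp , sq ← row-singleton-edge (<-trans (n<1+n r) r+1<K)
      with p<q , q<m ← CycleEdge-bounds pq
      with weak⇒singleton-endpoint weak (cycle-adj pq r+1<K)
    ... | inj₁ sp′ = singleton-rung (<-trans p<q q<m) r+1<K sp sp′
    ... | inj₂ sq′ = singleton-rung q<m r+1<K sq sq′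

    lower-bound : 2 * n + 1 ≤ monoCount G f
    lower-bound =
      subst (_≤ monoCount G f) (sym (2*n+1≡1+n+n n)) (≤-monoCount key (suc (n + n)) mono-edge-with-key)
      where
      mono-edge-with-key : ∀ j → j < suc (n + n) → ∃₂ λ u v → IsMonoEdge u v × key u v ≡ j
      mono-edge-with-key j j<1+n+n with halve j
      ... | h , inj₁ refl = row-mono-edge {h} (s≤s (double-cancel-≤ (s≤s⁻¹ j<1+n+n)))
      ... | h , inj₂ refl = rung-mono-edge {h} (s≤s (double-cancel-< (s≤s⁻¹ j<1+n+n)))

  colour : V → Parity
  colour u = parity (col u + row u)

  vertical-colours-differ : ∀ i r → parity (i + r) ≢ parity (i + suc r)
  vertical-colours-differ i r eq = parity≢parity-suc (i + r) (trans eq (cong parity (+-suc i r)))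

  horizontal-colours-differ : ∀ i r → parity (i + r) ≢ parity (suc i + r)
  horizontal-colours-differ i r = parity≢parity-suc (i + r)

  -- The last column has parity k (m = k + 3), so the wrap edges are properly coloured iff m is even.
  wrap-colours-differ : parity k ≡ 1ℙ → ∀ r → parity (0 + r) ≢ parity (pred m + r)
  wrap-colours-differ k-odd r eq =
    p≢p⁻¹ (parity r) (trans eq (trans (parity-+ k r) (cong (ℙ._+ parity r) k-odd)))

  wrap-colours-agree : parity k ≡ 0ℙ → ∀ r → parity (pred m + r) ≡ parity r
  wrap-colours-agree k-even r = trans (parity-+ k r) (cong (ℙ._+ parity r) k-even)

  col-order⁻¹ : ∀ {i j r} → K * i + r < K * j + r → i < j
  col-order⁻¹ {i} {j} {r} lt = *-cancelˡ-< K i j (+-cancelʳ-< r (K * i) (K * j) lt)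

  row-order⁻¹ : ∀ {i r s} → K * i + r < K * i + s → r < s
  row-order⁻¹ {i} = +-cancelˡ-< (K * i) _ _

  parity-last : parity (pred m) ≡ parity m ⁻¹
  parity-last = sym (suc-homo-⁻¹ k)

  module _ (even : parity m ≡ 0ℙ) where

    even⇒colours-differ : ∀ {i r j s} → Edge i r j s → parity (i + r) ≢ parity (j + s)
    even⇒colours-differ (up {i} {r})    = vertical-colours-differ i r
    even⇒colours-differ (down {i} {r})  = ≢-sym (vertical-colours-differ i r)
    even⇒colours-differ (right {i} {r}) = horizontal-colours-differ i r
    even⇒colours-differ (left {i} {r})  = ≢-sym (horizontal-colours-differ i r)
    even⇒colours-differ (wrap {r})      = wrap-colours-differ (trans parity-last (cong _⁻¹ even)) r
    even⇒colours-differ (unwrap {r})    = ≢-sym (wrap-colours-differ (trans parity-last (cong _⁻¹ even)) r)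

    private
      Black : V → Set
      Black u = colour u ≡ 1ℙ

      black-independent : ∀ {u v} → T (adj G u v) → Black u → ¬ Black v
      black-independent {u} {v} uv black-u black-v =
        even⇒colours-differ (edge {u} {v} uv) (trans black-u (sym black-v))

    open IndependentSetIndexer G loopless (λ u → colour u ≟ℙ 1ℙ) (λ {u} {v} → black-independent {u} {v})
    open MonoEdges G indexer

    no-mono-edges : ∀ {u v} → ¬ IsMonoEdge u v
    no-mono-edges {u} {v} (_ , uv , mono) with ¬black-u , ¬black-v ← mono⇒outside {u} {v} uv mono =
      even⇒colours-differ (edge {u} {v} uv) (trans (≢1ℙ⇒≡0ℙ ¬black-u) (sym (≢1ℙ⇒≡0ℙ ¬black-v)))

    even-sparing-number : SparingNumberIs G 0
    even-sparing-number =
      (indexer , indexer-isWeakIASI , n≤0⇒n≡0 (monoCount-≤ [] (⊥-elim ∘ no-mono-edges))) , λ _ _ → z≤n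

  module _ (odd : parity m ≡ 1ℙ) where

    private
      k-even : parity k ≡ 0ℙ
      k-even = trans parity-last (cong _⁻¹ odd)

      colours-differ-or-column-0 : ∀ {i r j s} → Edge i r j s →
                                   parity (i + r) ≢ parity (j + s) ⊎ (i ≡ 0 ⊎ j ≡ 0)
      colours-differ-or-column-0 (up {i} {r})    = inj₁ (vertical-colours-differ i r)
      colours-differ-or-column-0 (down {i} {r})  = inj₁ (≢-sym (vertical-colours-differ i r))
      colours-differ-or-column-0 (right {i} {r}) = inj₁ (horizontal-colours-differ i r)
      colours-differ-or-column-0 (left {i} {r})  = inj₁ (≢-sym (horizontal-colours-differ i r))
      colours-differ-or-column-0 wrap            = inj₂ (inj₁ refl)
      colours-differ-or-column-0 unwrap          = inj₂ (inj₂ refl)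

      -- Column 0 is left out to absorb the odd wrap-around.
      Chosen : V → Set
      Chosen u = colour u ≡ 1ℙ × col u ≢ 0

      chosen-independent : ∀ {u v} → T (adj G u v) → Chosen u → ¬ Chosen v
      chosen-independent {u} {v} uv (black-u , u∉col₀) (black-v , v∉col₀)
        with colours-differ-or-column-0 (edge {u} {v} uv)
      ... | inj₁ differ       = differ (trans black-u (sym black-v))
      ... | inj₂ (inj₁ u∈col₀) = u∉col₀ u∈col₀
      ... | inj₂ (inj₂ v∈col₀) = v∉col₀ v∈col₀

      Unchosen : ℕ → ℕ → Set
      Unchosen i r = parity (i + r) ≡ 0ℙ ⊎ i ≡ 0

      unchosen : ∀ u → ¬ Chosen u → Unchosen (col u) (row u)
      unchosen u ¬chosen with col u ≟ 0
      ... | yes u∈col₀ = inj₂ u∈col₀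
      ... | no u∉col₀  = inj₁ (≢1ℙ⇒≡0ℙ (λ black-u → ¬chosen (black-u , u∉col₀)))

      canonicalFor : Parity → Parity → ℕ → V × V
      canonicalFor 1ℙ _  h = cell 0 h , cell 0 (suc h)
      canonicalFor 0ℙ 1ℙ h = cell 0 h , cell 1 h
      canonicalFor 0ℙ 0ℙ h = cell 0 h , cell (pred m) h

      -- The only edge with row sum j between unchosen cells: for odd j the rung of column 0,
      -- for even j = 2h the edge from (0, h) to whichever of (1, h) and (m - 1, h) is unchosen.
      canonical : ℕ → V × V
      canonical j = canonicalFor (parity j) (parity ⌊ j /2⌋) ⌊ j /2⌋

      canonical-rung : ∀ r → canonical (r + suc r) ≡ (cell 0 r , cell 0 (suc r))
      canonical-rung r rewrite +-suc r r | parity-suc (r + r) | parity-double r | ⌊1+n+n/2⌋≡n r = refl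

      canonical-right : ∀ r → parity r ≡ 1ℙ → canonical (r + r) ≡ (cell 0 r , cell 1 r)
      canonical-right r r-odd rewrite parity-double r | sym (n≡⌊n+n/2⌋ r) | r-odd = refl

      canonical-wrap : ∀ r → parity r ≡ 0ℙ → canonical (r + r) ≡ (cell 0 r , cell (pred m) r)
      canonical-wrap r r-even rewrite parity-double r | sym (n≡⌊n+n/2⌋ r) | r-even = refl

      rung-in-column-0 : ∀ {i r s} → parity (i + r) ≢ parity (i + s) → Unchosen i r → Unchosen i s → i ≡ 0
      rung-in-column-0 _      (inj₂ i≡0) _          = i≡0
      rung-in-column-0 _      (inj₁ _)   (inj₂ i≡0) = i≡0
      rung-in-column-0 differ (inj₁ c₁)  (inj₁ c₂)  = ⊥-elim (differ (trans c₁ (sym c₂)))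

      unchosen-edge-canonical : ∀ {i r j s} → K * i + r < K * j + s → Edge i r j s →
                                Unchosen i r → Unchosen j s →
                                (cell i r , cell j s) ≡ canonical (r + s)
      unchosen-edge-canonical _ (up {i} {r}) uᵣ uᵣ₊₁ with rung-in-column-0 (vertical-colours-differ i r) uᵣ uᵣ₊₁
      ... | refl = sym (canonical-rung r)
      unchosen-edge-canonical lt (down {r = r}) _ _ = ⊥-elim (<-asym (n<1+n r) (row-order⁻¹ lt))
      unchosen-edge-canonical _ (right {i} {r}) (inj₁ c₁)  (inj₁ c₂) =
        ⊥-elim (horizontal-colours-differ i r (trans c₁ (sym c₂)))
      unchosen-edge-canonical _ (right {r = r}) (inj₂ refl) (inj₁ c) =
        sym (canonical-right r (⁻¹≡0ℙ⇒≡1ℙ (trans (sym (parity-suc r)) c)))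
      unchosen-edge-canonical lt (left {i}) _ _ = ⊥-elim (<-asym (n<1+n i) (col-order⁻¹ lt))
      unchosen-edge-canonical _ (wrap {r}) _ (inj₁ c) =
        sym (canonical-wrap r (trans (sym (wrap-colours-agree k-even r)) c))
      unchosen-edge-canonical lt unwrap _ _ = ⊥-elim (n≮0 (col-order⁻¹ lt))

      row-sum< : ∀ {r s} → r < K → s < K → r + s < 2 * n + 1
      row-sum< {r} {s} r<K s<K =
        subst (r + s <_) (sym (2*n+1≡1+n+n n)) (s≤s (+-mono-≤ (s≤s⁻¹ r<K) (s≤s⁻¹ s<K)))

    open IndependentSetIndexer G loopless (λ u → (colour u ≟ℙ 1ℙ) ×-dec ¬? (col u ≟ 0))
                                          (λ {u} {v} → chosen-independent {u} {v})
    open MonoEdges G indexer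

    mono-edge-canonical : ∀ {u v} → IsMonoEdge u v → (u , v) ≡ canonical (row u + row v)
    mono-edge-canonical {u} {v} (u<v , uv , mono) with ¬chosen-u , ¬chosen-v ← mono⇒outside {u} {v} uv mono =
      trans (sym (cong₂ _,_ (cell-col-row u) (cell-col-row v)))
            (unchosen-edge-canonical (subst₂ _<_ (toℕ≡K*col+row u) (toℕ≡K*col+row v) u<v) (edge {u} {v} uv)
                                     (unchosen u ¬chosen-u) (unchosen v ¬chosen-v))

    upper-bound : monoCount G indexer ≤ 2 * n + 1
    upper-bound =
      subst (monoCount G indexer ≤_) (trans (length-map canonical (upTo (2 * n + 1))) (length-upTo (2 * n + 1)))
      (monoCount-≤ (map canonical (upTo (2 * n + 1))) λ {u} {v} mono →
        subst (_∈ map canonical (upTo (2 * n + 1))) (sym (mono-edge-canonical mono))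
              (∈-map⁺ canonical (∈-upTo⁺ (row-sum< (row<K u) (row<K v)))))

    odd-sparing-number : SparingNumberIs G (2 * n + 1)
    odd-sparing-number =
      (indexer , indexer-isWeakIASI , ≤-antisym upper-bound (LowerBound.lower-bound odd indexer-isWeakIASI)) ,
      λ _ weak → LowerBound.lower-bound odd weak

proposition2p5 : ∀ (m n : ℕ) → 3 ≤ m → 1 ≤ n →
    (m % 2 ≡ 0 → SparingNumberIs (Cycle m □ Path n) 0)
    × (m % 2 ≡ 1 → SparingNumberIs (Cycle m □ Path n) (2 * n + 1))
proposition2p5 (suc zero)          _ (s≤s ())       _
proposition2p5 (suc (suc zero))    _ (s≤s (s≤s ())) _
proposition2p5 (suc (suc (suc k))) n _ _ =
  (λ m%2≡0 → Prism.even-sparing-number k n (%2≡0⇒parity≡0ℙ (3 + k) m%2≡0)) ,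
  (λ m%2≡1 → Prism.odd-sparing-number k n (%2≡1⇒parity≡1ℙ (3 + k) m%2≡1))
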